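{- Let $S\subseteq X$ be a non-empty generalised nice set, let $I_S=\{a,b,a*b:\{a,b\}\in S\}$, and let $k\in I$. Then $S\cup\{\{0,0\}\}\cup\{\{0,i\}: i\in I\setminus\{k\}\}$ is a generalised nice set if and only if $k\notin I_S$.
   Context: Let $I=\{1,\dots,7\}$ and $I_0=I\cup\{0\}$. The Fano plane on $I$ has the seven lines $\{1,2,5\},\{5,6,7\},\{1,4,7\},\{1,3,6\},\{2,4,6\},\{2,3,7\},\{3,4,5\}$. For distinct $i,j\in I$, $i*j$ is the third point of the unique line containing $i$ and $j$. The operation is extended to $I_0$ by $0*i=i*0=i$ and $i*i=0$ for all $i\in I_0$. Let $X_0$ be the set of unordered pairs $\{i,j\}$ with $i,j\in I_0$, where $i=j$ is allowed, and $X=\{\{i,j\}:i,j\in I,\ i\neq j\}$. For $i,j,k\in I_0$ let $P_{\{i,j,k\}}=\{\{i,j\},\{j,k\},\{k,i\},\{i,j*k\},\{j,k*i\},\{k,i*j\}\}\subseteq X_0$. A subset $T\subseteq X_0$ is a generalised nice set if for all $i,j,k\in I_0$, $\{i,j\}\in T$ and $\{i*j,k\}\in T$ imply $P_{\{i,j,k\}}\subseteq T$. -}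

module Defs where

open import Data.Nat using (ℕ)
open import Data.Nat.DivMod using (_mod_)
open import Data.Fin using (Fin; zero; toℕ)
open import Data.Product using (_×_; Σ; ∃)
open import Data.Sum using (_⊎_)
open import Relation.Binary.PropositionalEquality using (_≡_; _≢_)

-- I₀ = {0,…,7} is Fin 8 (0 = zero); I = I₀ ∖ {0}.
I₀ : Set
I₀ = Fin 8

-- The Fano-plane operation on ℕ-codes, extended by 0*i = i*0 = i and i*i = 0.
starℕ : ℕ → ℕ → ℕ
starℕ 0 j = j
starℕ i 0 = i
starℕ 1 2 = 5
starℕ 1 5 = 2
starℕ 2 1 = 5
starℕ 2 5 = 1
starℕ 5 1 = 2
starℕ 5 2 = 1
starℕ 5 6 = 7
starℕ 5 7 = 6
starℕ 6 5 = 7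
starℕ 6 7 = 5
starℕ 7 5 = 6
starℕ 7 6 = 5
starℕ 1 4 = 7
starℕ 1 7 = 4
starℕ 4 1 = 7
starℕ 4 7 = 1
starℕ 7 1 = 4
starℕ 7 4 = 1
starℕ 1 3 = 6
starℕ 1 6 = 3
starℕ 3 1 = 6
starℕ 3 6 = 1
starℕ 6 1 = 3
starℕ 6 3 = 1
starℕ 2 4 = 6
starℕ 2 6 = 4
starℕ 4 2 = 6
starℕ 4 6 = 2
starℕ 6 2 = 4
starℕ 6 4 = 2
starℕ 2 3 = 7
starℕ 2 7 = 3
starℕ 3 2 = 7
starℕ 3 7 = 2
starℕ 7 2 = 3
starℕ 7 3 = 2
starℕ 3 4 = 5
starℕ 3 5 = 4
starℕ 4 3 = 5
starℕ 4 5 = 3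
starℕ 5 3 = 4
starℕ 5 4 = 3
starℕ _ _ = 0

infixl 7 _*_
_*_ : I₀ → I₀ → I₀
i * j = starℕ (toℕ i) (toℕ j) mod 8

-- A subset of X₀ (unordered pairs {i,j}, i = j allowed) is represented by a
-- symmetric predicate T on I₀ × I₀: {i,j} ∈ T  iff  T i j.
PairSet : Set₁
PairSet = I₀ → I₀ → Set

Symmetric : PairSet → Set
Symmetric T = ∀ i j → T i j → T j i

⊆X : PairSet → Set
⊆X T = ∀ i j → T i j → (i ≢ zero) × (j ≢ zero) × (i ≢ j)

NonEmpty : PairSet → Set
NonEmpty T = Σ I₀ λ i → Σ I₀ λ j → T i j

P⊆ : I₀ → I₀ → I₀ → PairSet → Set
P⊆ i j k T = T i j × T j k × T k i × T i (j * k) × T j (k * i) × T k (i * j)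

GeneralisedNice : PairSet → Set
GeneralisedNice T = ∀ i j k → T i j → T (i * j) k → P⊆ i j k T

_∈I_ : I₀ → PairSet → Set
k ∈I S = Σ I₀ λ a → Σ I₀ λ b → S a b × ((k ≡ a) ⊎ (k ≡ b) ⊎ (k ≡ a * b))

extend : PairSet → I₀ → PairSet
extend S k i j =
  S i j
  ⊎ ((i ≡ zero) × (j ≡ zero))
  ⊎ ((i ≡ zero) × (j ≢ zero) × (j ≢ k))
  ⊎ ((j ≡ zero) × (i ≢ zero) × (i ≢ k))

-- Write T for S extended by k.  The zero row {x : {0,x} ∈ T} of T is I₀ ∖ {k}, so
-- k ∉ I_S says exactly that for every pair {a,b} of S the points a, b and a*b lie in
-- the zero row; the added pairs {0,x} satisfy this as well.  If T is nice, the
-- condition on {a,0} and {a*0,b} = {a,b} moves b and a*b into the zero row as soon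
-- as a is, and since a ≠ b one of a, b differs from k.  Conversely, when every pair
-- of a symmetric T has its three points in the zero row, P_{0,j,l} ⊆ T for every
-- {j,l} ∈ T; up to permuting i, j, l this settles every instance of niceness for T
-- except those with {i,j} and {i*j,l} both in S, which are instances for S.
module Submission where

open import Defs
open import Data.Fin using (zero)
open import Data.Fin.Properties using (_≟_; all?)
open import Data.Product using (_×_; _,_; proj₁; proj₂)
open import Data.Sum using (_⊎_; inj₁; inj₂)
open import Data.Empty using (⊥-elim)
open import Relation.Nullary using (¬_; yes; no)
open import Relation.Nullary.Decidable using (from-yes; _→-dec_)
open import Relation.Binary.PropositionalEquality using (_≡_; _≢_; refl; sym; subst)

*-identityˡ : ∀ i → zero * i ≡ i
*-identityˡ = from-yes (all? λ i → zero * i ≟ i)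

*-identityʳ : ∀ i → i * zero ≡ i
*-identityʳ = from-yes (all? λ i → i * zero ≟ i)

*-comm : ∀ i j → i * j ≡ j * i
*-comm = from-yes (all? λ i → all? λ j → i * j ≟ j * i)

*≡zero⇒≡ : ∀ i j → i * j ≡ zero → i ≡ j
*≡zero⇒≡ = from-yes (all? λ i → all? λ j → (i * j ≟ zero) →-dec (i ≟ j))

ZeroRowCovers : PairSet → PairSet → Set
ZeroRowCovers S T = ∀ {a b} → S a b → T zero a × T zero b × T zero (a * b)

P⊆-mono : ∀ {T U : PairSet} → (∀ {a b} → T a b → U a b) →
          ∀ {i j k} → P⊆ i j k T → P⊆ i j k U
P⊆-mono T⊆U (p , q , r , s , t , u) = T⊆U p , T⊆U q , T⊆U r , T⊆U s , T⊆U t , T⊆U u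

P⊆-rotate : ∀ {T i j k} → P⊆ i j k T → P⊆ j k i T
P⊆-rotate (ij , jk , ki , i[jk] , j[ki] , k[ij]) = jk , ki , ij , j[ki] , k[ij] , i[jk]

module _ {T : PairSet} (symT : Symmetric T) where

  P⊆-swap : ∀ {i j k} → P⊆ i j k T → P⊆ j i k T
  P⊆-swap {i} {j} {k} (ij , jk , ki , i[jk] , j[ki] , k[ij]) =
    symT _ _ ij , symT _ _ ki , symT _ _ jk ,
    subst (T j) (*-comm k i) j[ki] ,
    subst (T i) (*-comm j k) i[jk] ,
    subst (T k) (*-comm i j) k[ij]

  P⊆-zero : ZeroRowCovers T T → ∀ {j k} → T j k → P⊆ zero j k T
  P⊆-zero covers {j} {k} jk =
    let (0j , 0k , 0[jk]) = covers jk in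
    0j , jk , symT _ _ 0k , 0[jk] ,
    subst (T j) (sym (*-identityʳ k)) jk ,
    subst (T k) (sym (*-identityˡ j)) (symT _ _ jk)

  nice-zeroRow-closed : GeneralisedNice T → ∀ {a b} → T a b → T zero a →
                        T zero b × T zero (a * b)
  nice-zeroRow-closed nice {a} {b} ab 0a =
    let (_ , 0b , _ , _ , 0[ba] , _) =
          nice a zero b (symT _ _ 0a) (subst (λ x → T x b) (sym (*-identityʳ a)) ab)
    in 0b , subst (T zero) (*-comm b a) 0[ba]

module _ {S : PairSet} {k : I₀} where

  extend-symmetric : Symmetric S → Symmetric (extend S k)
  extend-symmetric symS i j (inj₁ ij)                 = inj₁ (symS i j ij)
  extend-symmetric symS i j (inj₂ (inj₁ (i≡0 , j≡0))) = inj₂ (inj₁ (j≡0 , i≡0))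
  extend-symmetric symS i j (inj₂ (inj₂ (inj₁ 0j)))   = inj₂ (inj₂ (inj₂ 0j))
  extend-symmetric symS i j (inj₂ (inj₂ (inj₂ i0)))   = inj₂ (inj₂ (inj₁ i0))

  extend-cases : ∀ {i j} → extend S k i j → S i j ⊎ i ≡ zero ⊎ j ≡ zero
  extend-cases (inj₁ ij)                      = inj₁ ij
  extend-cases (inj₂ (inj₁ (i≡0 , _)))        = inj₂ (inj₁ i≡0)
  extend-cases (inj₂ (inj₂ (inj₁ (i≡0 , _)))) = inj₂ (inj₁ i≡0)
  extend-cases (inj₂ (inj₂ (inj₂ (j≡0 , _)))) = inj₂ (inj₂ j≡0)

  extend-00 : extend S k zero zero
  extend-00 = inj₂ (inj₁ (refl , refl))

  zeroRow-extend⁺ : ∀ {x} → x ≢ k → extend S k zero x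
  zeroRow-extend⁺ {x} x≢k with x ≟ zero
  ... | yes x≡0 = inj₂ (inj₁ (refl , x≡0))
  ... | no x≢0  = inj₂ (inj₂ (inj₁ (refl , x≢0 , x≢k)))

  zeroRow-extend⁻ : ⊆X S → k ≢ zero → ∀ {x} → extend S k zero x → x ≢ k
  zeroRow-extend⁻ ⊆X-S k≢0 (inj₁ 0x)                         = ⊥-elim (proj₁ (⊆X-S _ _ 0x) refl)
  zeroRow-extend⁻ ⊆X-S k≢0 (inj₂ (inj₁ (_ , refl)))          = λ 0≡k → k≢0 (sym 0≡k)
  zeroRow-extend⁻ ⊆X-S k≢0 (inj₂ (inj₂ (inj₁ (_ , _ , x≢k)))) = x≢k
  zeroRow-extend⁻ ⊆X-S k≢0 (inj₂ (inj₂ (inj₂ (_ , 0≢0 , _)))) = ⊥-elim (0≢0 refl)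

  ∉I⇒zeroRowCovers : ¬ k ∈I S → ZeroRowCovers S (extend S k)
  ∉I⇒zeroRowCovers k∉ {a} {b} ab =
    zeroRow-extend⁺ (λ a≡k → k∉ (a , b , ab , inj₁ (sym a≡k))) ,
    zeroRow-extend⁺ (λ b≡k → k∉ (a , b , ab , inj₂ (inj₁ (sym b≡k)))) ,
    zeroRow-extend⁺ (λ ab≡k → k∉ (a , b , ab , inj₂ (inj₂ (sym ab≡k))))

  zeroRowCovers⇒∉I : ⊆X S → k ≢ zero → ZeroRowCovers S (extend S k) → ¬ k ∈I S
  zeroRowCovers⇒∉I ⊆X-S k≢0 covers (a , b , ab , k∈) with covers ab | k∈
  ... | 0a , _  , _     | inj₁ k≡a         = zeroRow-extend⁻ ⊆X-S k≢0 0a (sym k≡a)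
  ... | _  , 0b , _     | inj₂ (inj₁ k≡b)  = zeroRow-extend⁻ ⊆X-S k≢0 0b (sym k≡b)
  ... | _  , _  , 0[ab] | inj₂ (inj₂ k≡ab) = zeroRow-extend⁻ ⊆X-S k≢0 0[ab] (sym k≡ab)

  zeroRowCovers-extend : ZeroRowCovers S (extend S k) → ZeroRowCovers (extend S k) (extend S k)
  zeroRowCovers-extend covers (inj₁ ab) = covers ab
  zeroRowCovers-extend covers (inj₂ (inj₁ (refl , refl))) = extend-00 , extend-00 , extend-00
  zeroRowCovers-extend covers {b = b} (inj₂ (inj₂ (inj₁ (refl , _ , b≢k)))) =
    extend-00 , zeroRow-extend⁺ b≢k ,
    subst (extend S k zero) (sym (*-identityˡ b)) (zeroRow-extend⁺ b≢k)
  zeroRowCovers-extend covers {a} (inj₂ (inj₂ (inj₂ (refl , _ , a≢k)))) =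
    zeroRow-extend⁺ a≢k , extend-00 ,
    subst (extend S k zero) (sym (*-identityʳ a)) (zeroRow-extend⁺ a≢k)

  module _ (symS : Symmetric S) (⊆X-S : ⊆X S) where

    private
      symT : Symmetric (extend S k)
      symT = extend-symmetric symS

    nice⇒zeroRowCovers : k ≢ zero → GeneralisedNice (extend S k) → ZeroRowCovers S (extend S k)
    nice⇒zeroRowCovers k≢0 nice {a} {b} ab with a ≟ k
    ... | no a≢k =
      let 0a = zeroRow-extend⁺ a≢k
          (0b , 0[ab]) = nice-zeroRow-closed symT nice (inj₁ ab) 0a
      in 0a , 0b , 0[ab]
    ... | yes refl =
      let (_ , _ , a≢b) = ⊆X-S a b ab
          0b = zeroRow-extend⁺ (λ b≡a → a≢b (sym b≡a))
          (0a , _) = nice-zeroRow-closed symT nice (inj₁ (symS a b ab)) 0b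
      in ⊥-elim (zeroRow-extend⁻ ⊆X-S k≢0 0a refl)

    extend-nice : GeneralisedNice S → ZeroRowCovers (extend S k) (extend S k) →
                  GeneralisedNice (extend S k)
    extend-nice niceS covers i j l ij [ij]l with extend-cases ij
    ... | inj₁ S-ij with extend-cases [ij]l
    ...   | inj₁ S-[ij]l     = P⊆-mono {S} inj₁ (niceS i j l S-ij S-[ij]l)
    ...   | inj₂ (inj₁ ij≡0) = ⊥-elim (proj₂ (proj₂ (⊆X-S i j S-ij)) (*≡zero⇒≡ i j ij≡0))
    ...   | inj₂ (inj₂ refl) = P⊆-rotate {extend S k} (P⊆-zero symT covers ij)
    extend-nice niceS covers i j l ij [ij]l | inj₂ (inj₁ refl) =
      P⊆-zero symT covers (subst (λ x → extend S k x l) (*-identityˡ j) [ij]l)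
    extend-nice niceS covers i j l ij [ij]l | inj₂ (inj₂ refl) =
      P⊆-swap symT (P⊆-zero symT covers (subst (λ x → extend S k x l) (*-identityʳ i) [ij]l))

corollary6p13 : (S : PairSet) → Symmetric S → ⊆X S → NonEmpty S → GeneralisedNice S →
    (k : I₀) → k ≢ zero →
    (GeneralisedNice (extend S k) → ¬ (k ∈I S)) × (¬ (k ∈I S) → GeneralisedNice (extend S k))
corollary6p13 S symS ⊆X-S _ niceS k k≢0 =
  (λ nice → zeroRowCovers⇒∉I ⊆X-S k≢0 (nice⇒zeroRowCovers symS ⊆X-S k≢0 nice)) ,
  (λ k∉ → extend-nice symS ⊆X-S niceS (zeroRowCovers-extend (∉I⇒zeroRowCovers k∉)))
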